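{- In the edge-distinguishing game (EDGe) played on the path $P_5$ (with $\lambda(P_5)$ colors), Player 1 has a winning strategy.
   Context: $P_n$ is the path on $n$ vertices. For a positive integer $k$ let $[k]=\{1,\dots,k\}$. A $k$-coloring $c:V(G)\to[k]$ induces $c'(\{u,v\})=\{c(u),c(v)\}$ (a multiset); $c$ is edge-distinguishing if $c'$ is injective, and $\lambda(G)$ is the least $k$ admitting such a coloring. A partial coloring on $U\subseteq V(G)$ has partial induced edge coloring on $G[U]$. EDGe on $G$: two players, Player 1 first, alternately color an uncolored vertex with a color from $[\lambda(G)]$; a move is legal iff afterwards the partial induced edge coloring of the colored vertices is injective. The player making the last legal move wins. A winning strategy guarantees a win regardless of the opponent's play. -}

module Defs where

open import Data.Nat using (ℕ; suc; _<_)
open import Data.Fin using (Fin; inject₁; suc; _≟_)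
open import Data.Maybe using (Maybe; just; nothing)
open import Data.Product using (_×_; _,_; proj₁; proj₂; ∃-syntax)
open import Data.Sum using (_⊎_)
open import Relation.Nullary using (¬_; yes; no)
open import Relation.Binary.PropositionalEquality using (_≡_)

record Graph : Set where
  field
    nV    : ℕ
    nE    : ℕ
    ends  : Fin nE → Fin nV × Fin nV

open Graph public

Path : ℕ → Graph
Path m = record { nV = suc m ; nE = m ; ends = λ j → inject₁ j , suc j }

P₅ : Graph
P₅ = Path 4

SameMultiset : ∀ {k} → Fin k → Fin k → Fin k → Fin k → Set
SameMultiset a b c d = (a ≡ c × b ≡ d) ⊎ (a ≡ d × b ≡ c)

EdgeDistinguishing : (G : Graph) (k : ℕ) → (Fin (nV G) → Fin k) → Set
EdgeDistinguishing G k c =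
  ∀ (e₁ e₂ : Fin (nE G)) →
    SameMultiset (c (proj₁ (ends G e₁))) (c (proj₂ (ends G e₁)))
                 (c (proj₁ (ends G e₂))) (c (proj₂ (ends G e₂))) →
    e₁ ≡ e₂

IsLambda : Graph → ℕ → Set
IsLambda G k =
  (∃[ c ] EdgeDistinguishing G k c) ×
  (∀ j → j < k → ¬ (∃[ c ] EdgeDistinguishing G j c))

PartialColoring : Graph → ℕ → Set
PartialColoring G k = Fin (nV G) → Maybe (Fin k)

ValidPartial : (G : Graph) (k : ℕ) → PartialColoring G k → Set
ValidPartial G k p =
  ∀ (e₁ e₂ : Fin (nE G)) (a b c d : Fin k) →
    p (proj₁ (ends G e₁)) ≡ just a → p (proj₂ (ends G e₁)) ≡ just b →
    p (proj₁ (ends G e₂)) ≡ just c → p (proj₂ (ends G e₂)) ≡ just d →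
    SameMultiset a b c d → e₁ ≡ e₂

update : ∀ {G k} → PartialColoring G k → Fin (nV G) → Fin k → PartialColoring G k
update p v col w with w ≟ v
... | yes _ = just col
... | no  _ = p w

LegalMove : (G : Graph) (k : ℕ) → PartialColoring G k → Fin (nV G) → Fin k → Set
LegalMove G k p v col = (p v ≡ nothing) × ValidPartial G k (update {G} {k} p v col)

-- Game values (normal play: the player who makes the last legal move wins).
data WinsToMove (G : Graph) (k : ℕ) : PartialColoring G k → Set
data LosesToMove (G : Graph) (k : ℕ) : PartialColoring G k → Set

data WinsToMove G k where
  win : ∀ {p} (v : Fin (nV G)) (col : Fin k) →
        LegalMove G k p v col →
        LosesToMove G k (update {G} {k} p v col) →
        WinsToMove G k p

data LosesToMove G k where
  lose : ∀ {p} →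
         (∀ (v : Fin (nV G)) (col : Fin k) → LegalMove G k p v col →
            WinsToMove G k (update {G} {k} p v col)) →
         LosesToMove G k p

emptyColoring : ∀ {G k} → PartialColoring G k
emptyColoring _ = nothing

Player1Wins : Graph → ℕ → Set
Player1Wins G k = WinsToMove G k (emptyColoring {G} {k})

{-# OPTIONS --safe #-}
-- λ(P₅) = 3: the coloring 0,0,1,1,2 distinguishes the four edges of P₅, whereas two
-- colors induce only the three multisets {0,0}, {0,1}, {1,1}, and fewer colors embed
-- into two. With three colors the game tree of P₅ is small, so Player 1's winning
-- strategy is found by exhaustive search, which returns it as a WinsToMove derivation.
module Submission where

open import Defs
open import Data.Nat using (ℕ; zero; suc; _<_; s≤s)
open import Data.Nat.Properties using (≤-antisym; ≮⇒≥; n<1+n)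
open import Data.Fin using (Fin; zero; suc; inject≤; #_; _≟_)
open import Data.Fin.Properties using (all?; pigeonhole; <⇒≢; inject≤-injective)
open import Data.Maybe using (Maybe; just; nothing; _<∣>_; from-just)
import Data.Maybe as Maybe
import Data.Maybe.Properties as Maybe
open import Data.Product using (_,_; proj₁; proj₂)
import Data.Product as Product
import Data.Sum as Sum
open import Data.Vec using ([]; _∷_; lookup)
open import Data.Empty using (⊥-elim)
open import Function using (_∘_; const)
open import Function.Definitions using (Injective)
open import Relation.Nullary using (¬_; Dec; yes; no)
open import Relation.Nullary.Decidable using (_×-dec_; _⊎-dec_; _→-dec_; from-yes; map′)
open import Relation.Binary.PropositionalEquality using (_≡_; refl; sym; subst)

sameMultiset? : ∀ {k} (a b c d : Fin k) → Dec (SameMultiset a b c d)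
sameMultiset? a b c d = ((a ≟ c) ×-dec (b ≟ d)) ⊎-dec ((a ≟ d) ×-dec (b ≟ c))

sameMultiset-injective : ∀ {k l} {f : Fin k → Fin l} → Injective _≡_ _≡_ f →
  ∀ {a b c d} → SameMultiset (f a) (f b) (f c) (f d) → SameMultiset a b c d
sameMultiset-injective f-inj = Sum.map (Product.map f-inj f-inj) (Product.map f-inj f-inj)

edgeDistinguishing? : ∀ G k (c : Fin (nV G) → Fin k) → Dec (EdgeDistinguishing G k c)
edgeDistinguishing? G k c = all? λ e₁ → all? λ e₂ →
  sameMultiset? (end₁ e₁) (end₂ e₁) (end₁ e₂) (end₂ e₂) →-dec (e₁ ≟ e₂)
  where
  end₁ end₂ : Fin (nE G) → Fin k
  end₁ = c ∘ proj₁ ∘ ends G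
  end₂ = c ∘ proj₂ ∘ ends G

edgeDistinguishing-∘-injective : ∀ {G k l} {f : Fin k → Fin l} {c} → Injective _≡_ _≡_ f →
  EdgeDistinguishing G k c → EdgeDistinguishing G l (f ∘ c)
edgeDistinguishing-∘-injective f-inj ed e₁ e₂ = ed e₁ e₂ ∘ sameMultiset-injective f-inj

-- With two colors a multiset {a, b} is determined by how many of a, b equal 1.
twoColorMultisetCode : Fin 2 → Fin 2 → Fin 3
twoColorMultisetCode zero    zero    = # 0
twoColorMultisetCode (suc _) (suc _) = # 2
twoColorMultisetCode _       _       = # 1

twoColorMultisetCode-sameMultiset : ∀ a b c d →
  twoColorMultisetCode a b ≡ twoColorMultisetCode c d → SameMultiset a b c d
twoColorMultisetCode-sameMultiset = from-yes
  (all? λ a → all? λ b → all? λ c → all? λ d →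
     (twoColorMultisetCode a b ≟ twoColorMultisetCode c d) →-dec sameMultiset? a b c d)

twoColorings-notEdgeDistinguishing : ∀ G → 3 < nE G → (c : Fin (nV G) → Fin 2) →
  ¬ EdgeDistinguishing G 2 c
twoColorings-notEdgeDistinguishing G 3<nE c ed =
  let e₁ , e₂ , e₁<e₂ , sameCode = pigeonhole 3<nE edgeCode
  in <⇒≢ e₁<e₂ (ed e₁ e₂ (twoColorMultisetCode-sameMultiset _ _ _ _ sameCode))
  where
  edgeCode : Fin (nE G) → Fin 3
  edgeCode e = twoColorMultisetCode (c (proj₁ (ends G e))) (c (proj₂ (ends G e)))

fewerThan3Colorings-notEdgeDistinguishing : ∀ G {k} → 3 < nE G → k < 3 →
  (c : Fin (nV G) → Fin k) → ¬ EdgeDistinguishing G k c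
fewerThan3Colorings-notEdgeDistinguishing G 3<nE (s≤s k≤2) c ed =
  twoColorings-notEdgeDistinguishing G 3<nE (embed ∘ c)
    (edgeDistinguishing-∘-injective {G} {f = embed} {c} (inject≤-injective k≤2 k≤2 _ _) ed)
  where
  embed : Fin _ → Fin 2
  embed i = inject≤ i k≤2

P₅-threeColoring : Fin 5 → Fin 3
P₅-threeColoring = lookup (# 0 ∷ # 0 ∷ # 1 ∷ # 1 ∷ # 2 ∷ [])

P₅-threeColoring-edgeDistinguishing : EdgeDistinguishing P₅ 3 P₅-threeColoring
P₅-threeColoring-edgeDistinguishing = from-yes (edgeDistinguishing? P₅ 3 P₅-threeColoring)

IsLambda-P₅⇒≡3 : ∀ {k} → IsLambda P₅ k → k ≡ 3
IsLambda-P₅⇒≡3 ((c , ed) , minimal) = ≤-antisym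
  (≮⇒≥ λ 3<k → minimal 3 3<k (P₅-threeColoring , P₅-threeColoring-edgeDistinguishing))
  (≮⇒≥ λ k<3 → fewerThan3Colorings-notEdgeDistinguishing P₅ (n<1+n 3) k<3 c ed)

firstJust : ∀ {n} {A : Set} → (Fin n → Maybe A) → Maybe A
firstJust {zero}  _ = nothing
firstJust {suc n} f = f zero <∣> firstJust (f ∘ suc)

allJust : ∀ {n} {P : Fin n → Set} → (∀ i → Maybe (P i)) → Maybe (∀ i → P i)
allJust {zero}  _ = just λ ()
allJust {suc n} {P} f with f zero | allJust {n} {P ∘ suc} (f ∘ suc)
... | just p₀ | just pₛ = just λ { zero → p₀ ; (suc i) → pₛ i }
... | _       | _       = nothing

edgePairValid? : ∀ {k n} (e₁ e₂ : Fin n) (x₁ y₁ x₂ y₂ : Maybe (Fin k)) →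
  Dec (∀ a b c d → x₁ ≡ just a → y₁ ≡ just b → x₂ ≡ just c → y₂ ≡ just d →
       SameMultiset a b c d → e₁ ≡ e₂)
edgePairValid? e₁ e₂ (just a) (just b) (just c) (just d) =
  map′ (λ h → λ { _ _ _ _ refl refl refl refl → h }) (λ h → h a b c d refl refl refl refl)
    (sameMultiset? a b c d →-dec e₁ ≟ e₂)
edgePairValid? _ _ nothing  _        _        _        = yes λ { _ _ _ _ () }
edgePairValid? _ _ (just _) nothing  _        _        = yes λ { _ _ _ _ _ () }
edgePairValid? _ _ (just _) (just _) nothing  _        = yes λ { _ _ _ _ _ _ () }
edgePairValid? _ _ (just _) (just _) (just _) nothing  = yes λ { _ _ _ _ _ _ _ () }

module GameSearch (G : Graph) (k : ℕ) where

  Position : Set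
  Position = PartialColoring G k

  play : Position → Fin (nV G) → Fin k → Position
  play = update {G} {k}

  validPartial? : (p : Position) → Dec (ValidPartial G k p)
  validPartial? p = all? λ e₁ → all? λ e₂ →
    edgePairValid? e₁ e₂ (p (proj₁ (ends G e₁))) (p (proj₂ (ends G e₁)))
                         (p (proj₁ (ends G e₂))) (p (proj₂ (ends G e₂)))

  legalMove? : ∀ p v col → Dec (LegalMove G k p v col)
  legalMove? p v col = Maybe.≡-dec _≟_ (p v) nothing ×-dec validPartial? (play p v col)

  -- One unit of fuel covers a move of each player.
  searchWin  : ℕ → (p : Position) → Maybe (WinsToMove G k p)
  searchLoss : ℕ → (p : Position) → Maybe (LosesToMove G k p)
  winningMove : ℕ → ∀ p v col → Maybe (WinsToMove G k p)
  winningReply : ℕ → ∀ p v col →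
    Maybe (LegalMove G k p v col → WinsToMove G k (play p v col))

  searchWin zero    _ = nothing
  searchWin (suc n) p = firstJust λ v → firstJust λ col → winningMove n p v col

  searchLoss n p = Maybe.map lose (allJust λ v → allJust λ col → winningReply n p v col)

  winningMove n p v col with legalMove? p v col
  ... | yes legal = Maybe.map (win v col legal) (searchLoss n (play p v col))
  ... | no _      = nothing

  winningReply n p v col with legalMove? p v col
  ... | yes _       = Maybe.map const (searchWin n (play p v col))
  ... | no  illegal = just (⊥-elim ∘ illegal)

-- A game on five vertices lasts at most five moves, so three rounds of fuel suffice.
player1Wins-P₅ : Player1Wins P₅ 3
player1Wins-P₅ = from-just (GameSearch.searchWin P₅ 3 3 (emptyColoring {P₅} {3}))

theorem3p10 : ∀ (k : ℕ) → IsLambda P₅ k → Player1Wins P₅ k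
theorem3p10 k isLambda = subst (Player1Wins P₅) (sym (IsLambda-P₅⇒≡3 isLambda)) player1Wins-P₅
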